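{- For every integer $n\ge 1$, let $\mathrm{Av}_n(123)$ be the set of permutations of length $n$ avoiding $123$. The total number of occurrences of the pattern $12$ summed over all permutations in $\mathrm{Av}_n(123)$ equals $4^{n-1} - \binom{2n-1}{n}$, and the total number of occurrences of the pattern $21$ summed over all permutations in $\mathrm{Av}_n(123)$ equals $\binom{n}{2} c_n - 4^{n-1} + \binom{2n-1}{n}$, where $c_n = \frac{1}{n+1}\binom{2n}{n}$ is the $n$th Catalan number.
   Context: A permutation $\sigma=\sigma_1\cdots\sigma_k$ is contained in $\pi=\pi_1\cdots\pi_n$ if some subsequence of $\pi$ has the same relative order as $\sigma$; $\pi$ avoids $\sigma$ otherwise. An occurrence of $\sigma$ in $\pi$ is a set of indices $i_1<\dots<i_k$ such that $\pi_{i_1}\cdots\pi_{i_k}$ has the same relative order as $\sigma$; the number of occurrences is the number of such index sets. -}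

module Defs where

open import Data.Nat using (ℕ; zero; suc; _<ᵇ_; _≡ᵇ_; _+_)
open import Data.Bool using (Bool; true; false; _∧_; not; if_then_else_)
open import Data.List using (List; []; _∷_; map; concatMap; filter; length; upTo)
open import Data.Bool.ListAction using (and)
open import Data.Nat.ListAction using (sum)

allᵇ : {A : Set} → (A → Bool) → List A → Bool
allᵇ p xs = and (map p xs)
open import Data.Fin using (Fin)
open import Relation.Nullary.Decidable using (Dec; yes; no)
open import Data.Bool using (T)
open import Data.Bool.Properties using (T?)

-- Permutations of length n are the words π₁⋯πₙ over {0,…,n-1} with
-- pairwise distinct entries (values shifted down by 1 from the usual 1..n).

words : ℕ → ℕ → List (List ℕ)
words n zero    = [] ∷ []
words n (suc k) = concatMap (λ a → map (a ∷_) (words n k)) (upTo n)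

elemᵇ : ℕ → List ℕ → Bool
elemᵇ x []       = false
elemᵇ x (y ∷ ys) = if x ≡ᵇ y then true else elemᵇ x ys

distinctᵇ : List ℕ → Bool
distinctᵇ []       = true
distinctᵇ (x ∷ xs) = not (elemᵇ x xs) ∧ distinctᵇ xs

perms : ℕ → List (List ℕ)
perms n = filter (λ w → T? (distinctᵇ w)) (words n n)

-- all subsequences of a list, one for each set of indices
-- (so there are exactly 2^length entries, counted with multiplicity)
subseqs : List ℕ → List (List ℕ)
subseqs []       = [] ∷ []
subseqs (x ∷ xs) = map (x ∷_) (subseqs xs) Data.List.++ subseqs xs

sameLengthᵇ : List ℕ → List ℕ → Bool
sameLengthᵇ []       []       = true
sameLengthᵇ (_ ∷ xs) (_ ∷ ys) = sameLengthᵇ xs ys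
sameLengthᵇ _        _        = false

open import Data.Product using (_×_; _,_)

iffᵇ : Bool → Bool → Bool
iffᵇ true  b = b
iffᵇ false b = not b

sameOrderᵇ : List ℕ → List ℕ → Bool
sameOrderᵇ τ σ =
  sameLengthᵇ τ σ ∧
  allᵇ (λ { (a , b) → allᵇ (λ { (c , d) → iffᵇ (a <ᵇ c) (b <ᵇ d) }) ps }) ps
  where ps = Data.List.zip τ σ

occ : List ℕ → List ℕ → ℕ
occ σ π = length (filter (λ s → T? (sameOrderᵇ s σ)) (subseqs π))

avoidsᵇ : List ℕ → List ℕ → Bool
avoidsᵇ σ π = occ σ π ≡ᵇ 0

-- patterns (written with values 1,2,3 as in the paper; only relative order matters)
p12 p21 p123 : List ℕ
p12  = 1 ∷ 2 ∷ []
p21  = 2 ∷ 1 ∷ []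
p123 = 1 ∷ 2 ∷ 3 ∷ []

Av : ℕ → List ℕ → List (List ℕ)
Av n σ = filter (λ π → T? (avoidsᵇ σ π)) (perms n)

totalOcc : ℕ → List ℕ → List ℕ → ℕ
totalOcc n σ τ = sum (map (occ τ) (Av n σ))

-- A permutation of {0,…,m} is a first letter b followed by a permutation σ of {0,…,m-1} with b punched in;
-- the new 12-patterns number m - b, and the new 123-patterns are the 12-patterns of σ with entries ≥ b. This
-- suggests refining 123-avoidance by a threshold t: σ is admissible if it avoids 123 and its entries ≥ t
-- decrease. The number A(m,t) of admissible permutations of length m satisfies the ballot recursion, so
-- A(m,t) = C(m+t,t) - C(m+t,t-1) and A(n,n) is the Catalan number; the total number B(m,t) of 12-patterns
-- in them satisfies a recursion solved by partial sums of binomial coefficients, which at t = m = n gives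
-- B(n,n) = Σ_{i<n-1} C(2n-1,i) = 4^(n-1) - C(2n-1,n). Since every permutation of length n has C(n,2)
-- patterns 12 or 21, the count of 21-patterns follows.

module Submission where

open import Defs

module _ where
  open import Data.Bool using (Bool; true; false; if_then_else_; _∧_; not; T)
  open import Data.Bool.Properties using (T?; ∧-zeroʳ)
  open import Data.Empty using (⊥-elim)
  open import Data.Sum using (inj₁; inj₂)
  open import Data.List using (List; []; _∷_; map; filter; length; _++_; concatMap; upTo)
  open import Data.List.Properties
    using (length-map; map-++; map-∘; map-cong; map-cong-local; map-id-local; upTo-∷ʳ; ++-identityʳ;
           filter-all; filter-++)
  open import Data.List.Relation.Unary.All.Properties using (applyUpTo⁺₁)
  open import Data.Nat
  open import Data.Nat.DivMod using (m*n/n≡m)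
  open import Data.Nat.ListAction using (sum)
  open import Data.Nat.ListAction.Properties using (sum-++)
  open import Data.Nat.Properties
  open import Data.Nat.Tactic.RingSolver using (solve-∀)
  open import Data.Nat.Combinatorics using (_C_; nC1≡n; nCk≡nC[n∸k]; nCk+nC[k+1]≡[n+1]C[k+1])
  open import Relation.Binary.PropositionalEquality
  open import Function using (id; _∘_)
  open import Relation.Nullary using (¬_; yes; no)
  open import Relation.Binary.Definitions using (tri<; tri≈; tri>)
  open import Algebra.Properties.CommutativeSemigroup +-commutativeSemigroup using (interchange)

  private variable
    A B : Set

  T-⇔⇒≡ : ∀ {x y} → (T x → T y) → (T y → T x) → x ≡ y
  T-⇔⇒≡ {false} {false} _ _ = refl
  T-⇔⇒≡ {false} {true}  _ g = ⊥-elim (g _)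
  T-⇔⇒≡ {true}  {false} f _ = ⊥-elim (f _)
  T-⇔⇒≡ {true}  {true}  _ _ = refl

  <ᵇ-≡ : ∀ {m n u v} → (m < n → u < v) → (u < v → m < n) → (m <ᵇ n) ≡ (u <ᵇ v)
  <ᵇ-≡ f g = T-⇔⇒≡ (λ p → <⇒<ᵇ (f (<ᵇ⇒< _ _ p))) (λ p → <⇒<ᵇ (g (<ᵇ⇒< _ _ p)))

  ≤ᵇ-≡ : ∀ {m n u v} → (m ≤ n → u ≤ v) → (u ≤ v → m ≤ n) → (m ≤ᵇ n) ≡ (u ≤ᵇ v)
  ≤ᵇ-≡ f g = T-⇔⇒≡ (λ p → ≤⇒≤ᵇ (f (≤ᵇ⇒≤ _ _ p))) (λ p → ≤⇒≤ᵇ (g (≤ᵇ⇒≤ _ _ p)))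

  ≡ᵇ-≡ : ∀ {m n u v} → (m ≡ n → u ≡ v) → (u ≡ v → m ≡ n) → (m ≡ᵇ n) ≡ (u ≡ᵇ v)
  ≡ᵇ-≡ f g = T-⇔⇒≡ (λ p → ≡⇒≡ᵇ _ _ (f (≡ᵇ⇒≡ _ _ p))) (λ p → ≡⇒≡ᵇ _ _ (g (≡ᵇ⇒≡ _ _ p)))

  <⇒<ᵇ≡true : ∀ {m n} → m < n → (m <ᵇ n) ≡ true
  <⇒<ᵇ≡true m<n = T-⇔⇒≡ _ (λ _ → <⇒<ᵇ m<n)

  ≮⇒<ᵇ≡false : ∀ {m n} → ¬ m < n → (m <ᵇ n) ≡ false
  ≮⇒<ᵇ≡false m≮n = T-⇔⇒≡ (λ p → m≮n (<ᵇ⇒< _ _ p)) λ ()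

  ≤⇒≤ᵇ≡true : ∀ {m n} → m ≤ n → (m ≤ᵇ n) ≡ true
  ≤⇒≤ᵇ≡true m≤n = T-⇔⇒≡ _ (λ _ → ≤⇒≤ᵇ m≤n)

  ≰⇒≤ᵇ≡false : ∀ {m n} → ¬ m ≤ n → (m ≤ᵇ n) ≡ false
  ≰⇒≤ᵇ≡false m≰n = T-⇔⇒≡ (λ p → m≰n (≤ᵇ⇒≤ _ _ p)) λ ()

  ≢⇒≡ᵇ≡false : ∀ {m n} → m ≢ n → (m ≡ᵇ n) ≡ false
  ≢⇒≡ᵇ≡false m≢n = T-⇔⇒≡ (λ p → m≢n (≡ᵇ⇒≡ _ _ p)) λ ()

  ≡ᵇ-refl : ∀ n → (n ≡ᵇ n) ≡ true
  ≡ᵇ-refl n = T-⇔⇒≡ _ (λ _ → ≡⇒≡ᵇ n n refl)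

  n<ᵇn≡false : ∀ n → (n <ᵇ n) ≡ false
  n<ᵇn≡false n = ≮⇒<ᵇ≡false (n≮n n)

  +-≡ᵇ0 : ∀ a b → ((a + b) ≡ᵇ 0) ≡ ((a ≡ᵇ 0) ∧ (b ≡ᵇ 0))
  +-≡ᵇ0 zero    b = refl
  +-≡ᵇ0 (suc a) b = refl

  sum-map-++ : (f : A → ℕ) (xs ys : List A) → sum (map f (xs ++ ys)) ≡ sum (map f xs) + sum (map f ys)
  sum-map-++ f xs ys = trans (cong sum (map-++ f xs ys)) (sum-++ (map f xs) (map f ys))

  sum-map-cong : {f g : A → ℕ} → (∀ x → f x ≡ g x) → (xs : List A) → sum (map f xs) ≡ sum (map g xs)
  sum-map-cong f≗g xs = cong sum (map-cong f≗g xs)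

  sum-map-+ : (f g : A → ℕ) (xs : List A) → sum (map (λ x → f x + g x) xs) ≡ sum (map f xs) + sum (map g xs)
  sum-map-+ f g []       = refl
  sum-map-+ f g (x ∷ xs) rewrite sum-map-+ f g xs = interchange (f x) (g x) _ _

  sum-map-*ˡ : (c : ℕ) (f : A → ℕ) (xs : List A) → sum (map (λ x → c * f x) xs) ≡ c * sum (map f xs)
  sum-map-*ˡ c f []       = sym (*-zeroʳ c)
  sum-map-*ˡ c f (x ∷ xs) rewrite sum-map-*ˡ c f xs = sym (*-distribˡ-+ c (f x) _)

  sum-map-concatMap : (f : B → ℕ) (g : A → List B) (xs : List A) →
    sum (map f (concatMap g xs)) ≡ sum (map (λ x → sum (map f (g x))) xs)
  sum-map-concatMap f g []       = refl
  sum-map-concatMap f g (x ∷ xs) =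
    trans (sum-map-++ f (g x) (concatMap g xs)) (cong (sum (map f (g x)) +_) (sum-map-concatMap f g xs))

  sum-map-filter : (p : A → Bool) (f : A → ℕ) (xs : List A) →
    sum (map f (filter (λ x → T? (p x)) xs)) ≡ sum (map (λ x → if p x then f x else 0) xs)
  sum-map-filter p f []       = refl
  sum-map-filter p f (x ∷ xs) with p x
  ... | true  = cong (f x +_) (sum-map-filter p f xs)
  ... | false = sum-map-filter p f xs

  sum-map-upTo-suc : (f : ℕ → ℕ) (n : ℕ) → sum (map f (upTo (suc n))) ≡ sum (map f (upTo n)) + f n
  sum-map-upTo-suc f n = begin
    sum (map f (upTo (suc n)))        ≡⟨ cong (sum ∘ map f) (upTo-∷ʳ n) ⟨
    sum (map f (upTo n ++ n ∷ []))    ≡⟨ sum-map-++ f (upTo n) (n ∷ []) ⟩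
    sum (map f (upTo n)) + (f n + 0)  ≡⟨ cong (sum (map f (upTo n)) +_) (+-identityʳ (f n)) ⟩
    sum (map f (upTo n)) + f n        ∎
    where open ≡-Reasoning

  sum-map-cong-upTo : ∀ {f g : ℕ → ℕ} n → (∀ b → b < n → f b ≡ g b) →
    sum (map f (upTo n)) ≡ sum (map g (upTo n))
  sum-map-cong-upTo {f} {g} n f≗g = cong sum (map-cong-local (applyUpTo⁺₁ id n (f≗g _)))

  countᵇ : (A → Bool) → List A → ℕ
  countᵇ p xs = sum (map (λ x → if p x then 1 else 0) xs)

  length-filter-T? : (p : A → Bool) (xs : List A) → length (filter (λ x → T? (p x)) xs) ≡ countᵇ p xs
  length-filter-T? p []       = refl
  length-filter-T? p (x ∷ xs) with p x
  ... | true  = cong suc (length-filter-T? p xs)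
  ... | false = length-filter-T? p xs

  countᵇ-++ : (p : A → Bool) (xs ys : List A) → countᵇ p (xs ++ ys) ≡ countᵇ p xs + countᵇ p ys
  countᵇ-++ p = sum-map-++ _

  countᵇ-map : (p : B → Bool) (f : A → B) (xs : List A) → countᵇ p (map f xs) ≡ countᵇ (λ x → p (f x)) xs
  countᵇ-map p f xs = cong sum (sym (map-∘ xs))

  countᵇ-cong : {p q : A → Bool} → (∀ x → p x ≡ q x) → (xs : List A) → countᵇ p xs ≡ countᵇ q xs
  countᵇ-cong p≗q = sum-map-cong (λ x → cong (if_then 1 else 0) (p≗q x))

  countᵇ-none : {p : A → Bool} → (∀ x → p x ≡ false) → (xs : List A) → countᵇ p xs ≡ 0
  countᵇ-none ¬p []       = refl
  countᵇ-none ¬p (x ∷ xs) rewrite ¬p x = countᵇ-none ¬p xs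

  countᵇ-mono : {p q : A → Bool} → (∀ x → T (p x) → T (q x)) → (xs : List A) →
    countᵇ p xs ≤ countᵇ q xs
  countᵇ-mono p⇒q []       = z≤n
  countᵇ-mono {p = p} {q} p⇒q (x ∷ xs) with p x | q x | p⇒q x
  ... | true  | true  | _   = s≤s (countᵇ-mono p⇒q xs)
  ... | true  | false | imp = ⊥-elim (imp _)
  ... | false | true  | _   = m≤n⇒m≤1+n (countᵇ-mono p⇒q xs)
  ... | false | false | _   = countᵇ-mono p⇒q xs

  countᵇ-complement : {p q : A → Bool} → (∀ x → q x ≡ not (p x)) → (xs : List A) →
    countᵇ p xs + countᵇ q xs ≡ length xs
  countᵇ-complement q≗¬p [] = refl
  countᵇ-complement {p = p} q≗¬p (x ∷ xs) rewrite q≗¬p x with p x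
  ... | true  = cong suc (countᵇ-complement q≗¬p xs)
  ... | false = trans (+-suc _ _) (cong suc (countᵇ-complement q≗¬p xs))

  pairCount : (A → A → Bool) → List A → ℕ
  pairCount q []       = 0
  pairCount q (y ∷ ys) = countᵇ (q y) ys + pairCount q ys

  pairCount-cong : {q r : A → A → Bool} → (∀ y z → q y z ≡ r y z) → (xs : List A) →
    pairCount q xs ≡ pairCount r xs
  pairCount-cong q≗r []       = refl
  pairCount-cong q≗r (y ∷ ys) = cong₂ _+_ (countᵇ-cong (q≗r y) ys) (pairCount-cong q≗r ys)

  pairCount-map : (q : B → B → Bool) (f : A → B) (xs : List A) →
    pairCount q (map f xs) ≡ pairCount (λ y z → q (f y) (f z)) xs
  pairCount-map q f []       = refl
  pairCount-map q f (y ∷ ys) = cong₂ _+_ (countᵇ-map (q (f y)) f ys) (pairCount-map q f ys)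

  pairCount-mono : {q r : A → A → Bool} → (∀ y z → T (q y z) → T (r y z)) → (xs : List A) →
    pairCount q xs ≤ pairCount r xs
  pairCount-mono q⇒r []       = z≤n
  pairCount-mono q⇒r (y ∷ ys) = +-mono-≤ (countᵇ-mono (q⇒r y) ys) (pairCount-mono q⇒r ys)

  -- Occurrences of 12, 21 and 123

  countᵇ-subseqs-∷ : (R : List ℕ → Bool) (x : ℕ) (xs : List ℕ) →
    countᵇ R (subseqs (x ∷ xs)) ≡ countᵇ (λ s → R (x ∷ s)) (subseqs xs) + countᵇ R (subseqs xs)
  countᵇ-subseqs-∷ R x xs =
    trans (countᵇ-++ R (map (x ∷_) (subseqs xs)) (subseqs xs))
          (cong (_+ countᵇ R (subseqs xs)) (countᵇ-map R (x ∷_) (subseqs xs)))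

  countᵇ-subseqs-[] : (R : List ℕ → Bool) → (∀ y s → R (y ∷ s) ≡ false) → (xs : List ℕ) →
    countᵇ R (subseqs xs) ≡ (if R [] then 1 else 0)
  countᵇ-subseqs-[] R ¬R∷ []       = +-identityʳ _
  countᵇ-subseqs-[] R ¬R∷ (x ∷ xs) =
    trans (countᵇ-subseqs-∷ R x xs)
          (cong₂ _+_ (countᵇ-none (¬R∷ x) (subseqs xs)) (countᵇ-subseqs-[] R ¬R∷ xs))

  countᵇ-subseqs-singletons : (R : List ℕ → Bool) → R [] ≡ false → (∀ y z s → R (y ∷ z ∷ s) ≡ false) →
    (xs : List ℕ) → countᵇ R (subseqs xs) ≡ countᵇ (λ y → R (y ∷ [])) xs
  countᵇ-subseqs-singletons R ¬R[] ¬R∷∷ []       rewrite ¬R[] = refl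
  countᵇ-subseqs-singletons R ¬R[] ¬R∷∷ (x ∷ xs) =
    trans (countᵇ-subseqs-∷ R x xs)
          (cong₂ _+_ (countᵇ-subseqs-[] (λ s → R (x ∷ s)) (¬R∷∷ x) xs)
                     (countᵇ-subseqs-singletons R ¬R[] ¬R∷∷ xs))

  countᵇ-subseqs-pairs : (R : List ℕ → Bool) → R [] ≡ false → (∀ y → R (y ∷ []) ≡ false) →
    (∀ y z w s → R (y ∷ z ∷ w ∷ s) ≡ false) →
    (xs : List ℕ) → countᵇ R (subseqs xs) ≡ pairCount (λ y z → R (y ∷ z ∷ [])) xs
  countᵇ-subseqs-pairs R ¬R[] ¬R[_] ¬R∷∷∷ []       rewrite ¬R[] = refl
  countᵇ-subseqs-pairs R ¬R[] ¬R[_] ¬R∷∷∷ (x ∷ xs) =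
    trans (countᵇ-subseqs-∷ R x xs)
          (cong₂ _+_ (countᵇ-subseqs-singletons (λ s → R (x ∷ s)) ¬R[ x ] (¬R∷∷∷ x) xs)
                     (countᵇ-subseqs-pairs R ¬R[] ¬R[_] ¬R∷∷∷ xs))

  occ-∷ : (σ : List ℕ) (x : ℕ) (xs : List ℕ) →
    occ σ (x ∷ xs) ≡ countᵇ (λ s → sameOrderᵇ (x ∷ s) σ) (subseqs xs) + occ σ xs
  occ-∷ σ x xs = begin
    occ σ (x ∷ xs)                                                   ≡⟨ length-filter-T? R (subseqs (x ∷ xs)) ⟩
    countᵇ R (subseqs (x ∷ xs))                                      ≡⟨ countᵇ-subseqs-∷ R x xs ⟩
    countᵇ (λ s → R (x ∷ s)) (subseqs xs) + countᵇ R (subseqs xs)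
      ≡⟨ cong (countᵇ (λ s → R (x ∷ s)) (subseqs xs) +_) (length-filter-T? R (subseqs xs)) ⟨
    countᵇ (λ s → R (x ∷ s)) (subseqs xs) + occ σ xs                ∎
    where
    open ≡-Reasoning
    R : List ℕ → Bool
    R s = sameOrderᵇ s σ

  sameOrder-12 : ∀ x y → sameOrderᵇ (x ∷ y ∷ []) p12 ≡ (x <ᵇ y)
  sameOrder-12 x y with <-cmp x y
  ... | tri< x<y _ y≮x rewrite <⇒<ᵇ≡true x<y | ≮⇒<ᵇ≡false y≮x | n<ᵇn≡false x | n<ᵇn≡false y = refl
  ... | tri≈ _ refl _  rewrite n<ᵇn≡false x = refl
  ... | tri> x≮y _ y<x rewrite ≮⇒<ᵇ≡false x≮y | <⇒<ᵇ≡true y<x | n<ᵇn≡false x = refl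

  sameOrder-21 : ∀ x y → sameOrderᵇ (x ∷ y ∷ []) p21 ≡ (y <ᵇ x)
  sameOrder-21 x y with <-cmp x y
  ... | tri< x<y _ y≮x rewrite <⇒<ᵇ≡true x<y | ≮⇒<ᵇ≡false y≮x | n<ᵇn≡false x = refl
  ... | tri≈ _ refl _  rewrite n<ᵇn≡false x = refl
  ... | tri> x≮y _ y<x rewrite ≮⇒<ᵇ≡false x≮y | <⇒<ᵇ≡true y<x | n<ᵇn≡false x | n<ᵇn≡false y = refl

  sameOrder-123 : ∀ x y z → sameOrderᵇ (x ∷ y ∷ z ∷ []) p123 ≡ ((x <ᵇ y) ∧ (y <ᵇ z))
  sameOrder-123 x y z rewrite n<ᵇn≡false x | n<ᵇn≡false y | n<ᵇn≡false z with <-cmp x y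
  ... | tri≈ x≮y _ _ rewrite ≮⇒<ᵇ≡false x≮y = refl
  ... | tri> x≮y _ _ rewrite ≮⇒<ᵇ≡false x≮y = refl
  ... | tri< x<y _ y≮x rewrite <⇒<ᵇ≡true x<y | ≮⇒<ᵇ≡false y≮x with <-cmp y z
  ...   | tri< y<z _ z≮y
          rewrite <⇒<ᵇ≡true y<z | ≮⇒<ᵇ≡false z≮y | <⇒<ᵇ≡true (<-trans x<y y<z)
                | ≮⇒<ᵇ≡false (<⇒≯ (<-trans x<y y<z)) = refl
  ...   | tri≈ _ refl _ rewrite n<ᵇn≡false y | <⇒<ᵇ≡true x<y = refl
  ...   | tri> y≮z _ _ rewrite ≮⇒<ᵇ≡false y≮z with x <ᵇ z
  ...     | true  = refl
  ...     | false = refl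

  count12 count21 count123 : List ℕ → ℕ
  count12 = pairCount _<ᵇ_
  count21 = pairCount (λ y z → z <ᵇ y)

  count12≥ : ℕ → List ℕ → ℕ
  count12≥ t = pairCount (λ y z → (t ≤ᵇ y) ∧ (y <ᵇ z))

  count123 []       = 0
  count123 (x ∷ xs) = count12≥ (suc x) xs + count123 xs

  occ-12 : ∀ xs → occ p12 xs ≡ count12 xs
  occ-12 []       = refl
  occ-12 (x ∷ xs) = trans (occ-∷ p12 x xs) (cong₂ _+_
    (trans (countᵇ-subseqs-singletons _ refl (λ _ _ _ → refl) xs) (countᵇ-cong (sameOrder-12 x) xs))
    (occ-12 xs))

  occ-21 : ∀ xs → occ p21 xs ≡ count21 xs
  occ-21 []       = refl
  occ-21 (x ∷ xs) = trans (occ-∷ p21 x xs) (cong₂ _+_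
    (trans (countᵇ-subseqs-singletons _ refl (λ _ _ _ → refl) xs) (countᵇ-cong (sameOrder-21 x) xs))
    (occ-21 xs))

  occ-123 : ∀ xs → occ p123 xs ≡ count123 xs
  occ-123 []       = refl
  occ-123 (x ∷ xs) = trans (occ-∷ p123 x xs) (cong₂ _+_
    (trans (countᵇ-subseqs-pairs _ refl (λ _ → refl) (λ _ _ _ _ → refl) xs)
           (pairCount-cong (sameOrder-123 x) xs))
    (occ-123 xs))

  -- Inserting a first letter

  punchIn : ℕ → ℕ → ℕ
  punchIn b v = if v <ᵇ b then v else suc v

  punchIn-< : ∀ {b v} → v < b → punchIn b v ≡ v
  punchIn-< v<b rewrite <⇒<ᵇ≡true v<b = refl

  punchIn-≥ : ∀ {b v} → b ≤ v → punchIn b v ≡ suc v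
  punchIn-≥ b≤v rewrite ≮⇒<ᵇ≡false (≤⇒≯ b≤v) = refl

  punchIn-mono-≤ : ∀ b {x y} → x ≤ y → punchIn b x ≤ punchIn b y
  punchIn-mono-≤ b {x} {y} x≤y with x <? b | y <? b
  ... | yes x<b | yes y<b rewrite punchIn-< x<b | punchIn-< y<b = x≤y
  ... | yes x<b | no  y≮b rewrite punchIn-< x<b | punchIn-≥ (≮⇒≥ y≮b) = m≤n⇒m≤1+n x≤y
  ... | no  x≮b | yes y<b = ⊥-elim (<⇒≱ y<b (≤-trans (≮⇒≥ x≮b) x≤y))
  ... | no  x≮b | no  y≮b rewrite punchIn-≥ (≮⇒≥ x≮b) | punchIn-≥ (≮⇒≥ y≮b) = s≤s x≤y

  punchIn-mono-< : ∀ b {x y} → x < y → punchIn b x < punchIn b y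
  punchIn-mono-< b {x} {y} x<y with x <? b | y <? b
  ... | yes x<b | yes y<b rewrite punchIn-< x<b | punchIn-< y<b = x<y
  ... | yes x<b | no  y≮b rewrite punchIn-< x<b | punchIn-≥ (≮⇒≥ y≮b) = m<n⇒m<1+n x<y
  ... | no  x≮b | yes y<b = ⊥-elim (<⇒≱ y<b (≤-trans (≮⇒≥ x≮b) (<⇒≤ x<y)))
  ... | no  x≮b | no  y≮b rewrite punchIn-≥ (≮⇒≥ x≮b) | punchIn-≥ (≮⇒≥ y≮b) = s<s x<y

  punchIn-<ᵇ : ∀ b x y → (punchIn b x <ᵇ punchIn b y) ≡ (x <ᵇ y)
  punchIn-<ᵇ b x y = <ᵇ-≡ (λ p → ≰⇒> λ y≤x → <⇒≱ p (punchIn-mono-≤ b y≤x)) (punchIn-mono-< b)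

  punchIn-≡ᵇ : ∀ b x y → (punchIn b x ≡ᵇ punchIn b y) ≡ (x ≡ᵇ y)
  punchIn-≡ᵇ b x y = ≡ᵇ-≡ injective (cong (punchIn b))
    where
    injective : punchIn b x ≡ punchIn b y → x ≡ y
    injective eq with <-cmp x y
    ... | tri< x<y _ _ = ⊥-elim (<⇒≢ (punchIn-mono-< b x<y) eq)
    ... | tri≈ _ x≡y _ = x≡y
    ... | tri> _ _ y<x = ⊥-elim (<⇒≢ (punchIn-mono-< b y<x) (sym eq))

  punchIn-≤ᵇ-below : ∀ b {t} y → t ≤ b → (t ≤ᵇ punchIn b y) ≡ (t ≤ᵇ y)
  punchIn-≤ᵇ-below b y t≤b with y <? b
  ... | yes y<b rewrite punchIn-< y<b = refl
  ... | no  y≮b rewrite punchIn-≥ (≮⇒≥ y≮b) =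
    ≤ᵇ-≡ (λ _ → ≤-trans t≤b (≮⇒≥ y≮b)) (λ t≤y → m≤n⇒m≤1+n t≤y)

  punchIn-<ᵇ-above : ∀ b {t} y → b ≤ t → (t <ᵇ punchIn b y) ≡ (t ≤ᵇ y)
  punchIn-<ᵇ-above b {t} y b≤t with y <? b
  ... | yes y<b rewrite punchIn-< y<b =
    trans (≮⇒<ᵇ≡false (λ t<y → <⇒≱ y<b (≤-trans b≤t (<⇒≤ t<y))))
          (sym (≰⇒≤ᵇ≡false (λ t≤y → <⇒≱ y<b (≤-trans b≤t t≤y))))
  ... | no  y≮b rewrite punchIn-≥ (≮⇒≥ y≮b) = ≤ᵇ-≡ {suc t} {suc y} ≤-pred s≤s

  punchIn-<ᵇ-pivot : ∀ b y → (punchIn b y <ᵇ b) ≡ (y <ᵇ b)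
  punchIn-<ᵇ-pivot b y with y <? b
  ... | yes y<b rewrite punchIn-< y<b = refl
  ... | no  y≮b rewrite punchIn-≥ (≮⇒≥ y≮b) =
    trans (≮⇒<ᵇ≡false (λ 1+y<b → y≮b (<-trans (n<1+n y) 1+y<b))) (sym (≮⇒<ᵇ≡false y≮b))

  elem-punchIn : ∀ b x w → elemᵇ (punchIn b x) (map (punchIn b) w) ≡ elemᵇ x w
  elem-punchIn b x []      = refl
  elem-punchIn b x (y ∷ w) rewrite punchIn-≡ᵇ b x y | elem-punchIn b x w = refl

  distinct-punchIn : ∀ b w → distinctᵇ (map (punchIn b) w) ≡ distinctᵇ w
  distinct-punchIn b []      = refl
  distinct-punchIn b (x ∷ w) rewrite elem-punchIn b x w | distinct-punchIn b w = refl

  -- Sums over permutations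

  sumWords : List ℕ → ℕ → (List ℕ → ℕ) → ℕ
  sumWords as zero    F = F []
  sumWords as (suc k) F = sum (map (λ a → sumWords as k (λ w → F (a ∷ w))) as)

  sum-words : ∀ n k F → sum (map F (words n k)) ≡ sumWords (upTo n) k F
  sum-words n zero    F = +-identityʳ (F [])
  sum-words n (suc k) F = trans (sum-map-concatMap F (λ a → map (a ∷_) (words n k)) (upTo n))
    (sum-map-cong (λ a → trans (cong sum (sym (map-∘ (words n k)))) (sum-words n k (λ w → F (a ∷ w))))
                  (upTo n))

  sumWords-cong : ∀ as k {F G : List ℕ → ℕ} → (∀ w → F w ≡ G w) → sumWords as k F ≡ sumWords as k G
  sumWords-cong as zero    F≗G = F≗G []
  sumWords-cong as (suc k) F≗G = sum-map-cong (λ a → sumWords-cong as k (λ w → F≗G (a ∷ w))) as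

  sumWords-+ : ∀ as k (F G : List ℕ → ℕ) →
    sumWords as k (λ w → F w + G w) ≡ sumWords as k F + sumWords as k G
  sumWords-+ as zero    F G = refl
  sumWords-+ as (suc k) F G = trans (sum-map-cong (λ a → sumWords-+ as k _ _) as) (sum-map-+ _ _ as)

  sumWords-*ˡ : ∀ as k c (F : List ℕ → ℕ) → sumWords as k (λ w → c * F w) ≡ c * sumWords as k F
  sumWords-*ˡ as zero    c F = refl
  sumWords-*ˡ as (suc k) c F = trans (sum-map-cong (λ a → sumWords-*ˡ as k c _) as) (sum-map-*ˡ c _ as)

  sumWords-map : ∀ (f : ℕ → ℕ) as k F → sumWords (map f as) k F ≡ sumWords as k (λ w → F (map f w))
  sumWords-map f as zero    F = refl
  sumWords-map f as (suc k) F = trans (cong sum (sym (map-∘ as)))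
    (sum-map-cong (λ a → sumWords-map f as k (λ w → F (f a ∷ w))) as)

  avoiding : ℕ → (List ℕ → ℕ) → List ℕ → ℕ
  avoiding b F w = if elemᵇ b w then 0 else F w

  without : ℕ → List ℕ → List ℕ
  without b = filter (λ a → T? (not (b ≡ᵇ a)))

  sumWords-avoiding : ∀ as k b F → sumWords as k (avoiding b F) ≡ sumWords (without b as) k F
  sumWords-avoiding as zero    b F = refl
  sumWords-avoiding as (suc k) b F = begin
    sum (map (λ a → sumWords as k (λ w → avoiding b F (a ∷ w))) as)
      ≡⟨ sum-map-cong firstLetter as ⟩
    sum (map (λ a → if not (b ≡ᵇ a) then sumWords as k (avoiding b (λ w → F (a ∷ w))) else 0) as)
      ≡⟨ sum-map-filter (λ a → not (b ≡ᵇ a)) _ as ⟨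
    sum (map (λ a → sumWords as k (avoiding b (λ w → F (a ∷ w)))) (without b as))
      ≡⟨ sum-map-cong (λ a → sumWords-avoiding as k b (λ w → F (a ∷ w))) (without b as) ⟩
    sum (map (λ a → sumWords (without b as) k (λ w → F (a ∷ w))) (without b as))
      ∎
    where
    open ≡-Reasoning
    firstLetter : ∀ a → sumWords as k (λ w → avoiding b F (a ∷ w))
                      ≡ (if not (b ≡ᵇ a) then sumWords as k (avoiding b (λ w → F (a ∷ w))) else 0)
    firstLetter a with b ≡ᵇ a
    ... | true  = sumWords-*ˡ as k 0 (λ _ → 0)
    ... | false = refl

  without-upTo-< : ∀ {b} n → n ≤ b → without b (upTo n) ≡ upTo n
  without-upTo-< {b} n n≤b = filter-all (λ a → T? (not (b ≡ᵇ a))) (applyUpTo⁺₁ id n λ a<n →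
    subst T (sym (cong not (≢⇒≡ᵇ≡false (≢-sym (<⇒≢ (<-≤-trans a<n n≤b)))))) _)

  map-punchIn-upTo-< : ∀ {b} n → n ≤ b → map (punchIn b) (upTo n) ≡ upTo n
  map-punchIn-upTo-< {b} n n≤b = map-id-local (applyUpTo⁺₁ id n λ a<n → punchIn-< (<-≤-trans a<n n≤b))

  without-upTo : ∀ {b} m → b ≤ m → without b (upTo (suc m)) ≡ map (punchIn b) (upTo m)
  without-upTo {b} m b≤m with b ≟ m
  ... | yes refl = begin
    without b (upTo (suc b))                 ≡⟨ cong (without b) (upTo-∷ʳ b) ⟨
    without b (upTo b ++ b ∷ [])             ≡⟨ filter-++ (λ a → T? (not (b ≡ᵇ a))) (upTo b) (b ∷ []) ⟩
    without b (upTo b) ++ without b (b ∷ []) ≡⟨ cong₂ _++_ (without-upTo-< b ≤-refl) dropPivot ⟩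
    upTo b ++ []                             ≡⟨ ++-identityʳ (upTo b) ⟩
    upTo b                                   ≡⟨ map-punchIn-upTo-< b ≤-refl ⟨
    map (punchIn b) (upTo b)                 ∎
    where
    open ≡-Reasoning
    dropPivot : without b (b ∷ []) ≡ []
    dropPivot rewrite ≡ᵇ-refl b = refl
  without-upTo {b} zero    z≤n   | no b≢0 = ⊥-elim (b≢0 refl)
  without-upTo {b} (suc m) b≤1+m | no b≢1+m = begin
    without b (upTo (suc (suc m)))                     ≡⟨ cong (without b) (upTo-∷ʳ (suc m)) ⟨
    without b (upTo (suc m) ++ suc m ∷ [])             ≡⟨ filter-++ (λ a → T? (not (b ≡ᵇ a))) (upTo (suc m)) _ ⟩
    without b (upTo (suc m)) ++ without b (suc m ∷ []) ≡⟨ cong₂ _++_ (without-upTo m b≤m) keepLast ⟩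
    map (punchIn b) (upTo m) ++ punchIn b m ∷ []       ≡⟨ map-++ (punchIn b) (upTo m) (m ∷ []) ⟨
    map (punchIn b) (upTo m ++ m ∷ [])                 ≡⟨ cong (map (punchIn b)) (upTo-∷ʳ m) ⟩
    map (punchIn b) (upTo (suc m))                     ∎
    where
    open ≡-Reasoning
    b≤m : b ≤ m
    b≤m = ≤-pred (≤∧≢⇒< b≤1+m b≢1+m)
    keepLast : without b (suc m ∷ []) ≡ punchIn b m ∷ []
    keepLast rewrite ≢⇒≡ᵇ≡false b≢1+m | punchIn-≥ b≤m = refl

  onDistinct : (List ℕ → ℕ) → List ℕ → ℕ
  onDistinct G w = if distinctᵇ w then G w else 0

  onDistinct-∷ : ∀ G b w → onDistinct G (b ∷ w) ≡ avoiding b (onDistinct (λ w → G (b ∷ w))) w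
  onDistinct-∷ G b w with elemᵇ b w
  ... | true  = refl
  ... | false = refl

  sumPerms : ℕ → (List ℕ → ℕ) → ℕ
  sumPerms m G = sumWords (upTo m) m (onDistinct G)

  totalOcc-sumPerms : ∀ n σ τ → totalOcc n σ τ ≡ sumPerms n (λ π → if avoidsᵇ σ π then occ τ π else 0)
  totalOcc-sumPerms n σ τ = begin
    sum (map (occ τ) (filter (λ π → T? (avoidsᵇ σ π)) (perms n)))
      ≡⟨ sum-map-filter (avoidsᵇ σ) (occ τ) (perms n) ⟩
    sum (map (λ π → if avoidsᵇ σ π then occ τ π else 0) (filter (λ π → T? (distinctᵇ π)) (words n n)))
      ≡⟨ sum-map-filter distinctᵇ _ (words n n) ⟩
    sum (map (onDistinct (λ π → if avoidsᵇ σ π then occ τ π else 0)) (words n n))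
      ≡⟨ sum-words n n _ ⟩
    sumPerms n (λ π → if avoidsᵇ σ π then occ τ π else 0)
      ∎
    where open ≡-Reasoning

  sumPerms-suc : ∀ m G →
    sumPerms (suc m) G ≡ sum (map (λ b → sumPerms m (λ σ → G (b ∷ map (punchIn b) σ))) (upTo (suc m)))
  sumPerms-suc m G = sum-map-cong-upTo (suc m) firstLetter
    where
    open ≡-Reasoning
    firstLetter : ∀ b → b < suc m →
      sumWords (upTo (suc m)) m (λ w → onDistinct G (b ∷ w))
        ≡ sumPerms m (λ σ → G (b ∷ map (punchIn b) σ))
    firstLetter b b<1+m = begin
        sumWords (upTo (suc m)) m (λ w → onDistinct G (b ∷ w))
      ≡⟨ sumWords-cong _ m (onDistinct-∷ G b) ⟩
        sumWords (upTo (suc m)) m (avoiding b (onDistinct (λ w → G (b ∷ w))))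
      ≡⟨ sumWords-avoiding _ m b _ ⟩
        sumWords (without b (upTo (suc m))) m (onDistinct (λ w → G (b ∷ w)))
      ≡⟨ cong (λ as → sumWords as m (onDistinct (λ w → G (b ∷ w)))) (without-upTo m (≤-pred b<1+m)) ⟩
        sumWords (map (punchIn b) (upTo m)) m (onDistinct (λ w → G (b ∷ w)))
      ≡⟨ sumWords-map (punchIn b) (upTo m) m _ ⟩
        sumWords (upTo m) m (λ σ → onDistinct (λ w → G (b ∷ w)) (map (punchIn b) σ))
      ≡⟨ sumWords-cong _ m (λ σ → cong (if_then G (b ∷ map (punchIn b) σ) else 0) (distinct-punchIn b σ)) ⟩
        sumPerms m (λ σ → G (b ∷ map (punchIn b) σ))
      ∎

  -- The permutations of {0,…,m-1}, decomposed by their first letter as in sumPerms-suc.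
  data IsPerm : ℕ → List ℕ → Set where
    perm[] : IsPerm 0 []
    perm∷  : ∀ {m σ} b → b < suc m → IsPerm m σ → IsPerm (suc m) (b ∷ map (punchIn b) σ)

  sumPerms-cong : ∀ m {F G : List ℕ → ℕ} → (∀ σ → IsPerm m σ → F σ ≡ G σ) →
    sumPerms m F ≡ sumPerms m G
  sumPerms-cong zero    F≗G = F≗G [] perm[]
  sumPerms-cong (suc m) {F} {G} F≗G = begin
    sumPerms (suc m) F
      ≡⟨ sumPerms-suc m F ⟩
    sum (map (λ b → sumPerms m (λ σ → F (b ∷ map (punchIn b) σ))) (upTo (suc m)))
      ≡⟨ sum-map-cong-upTo (suc m) (λ b b<1+m → sumPerms-cong m (λ σ σ∈ → F≗G _ (perm∷ b b<1+m σ∈))) ⟩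
    sum (map (λ b → sumPerms m (λ σ → G (b ∷ map (punchIn b) σ))) (upTo (suc m)))
      ≡⟨ sumPerms-suc m G ⟨
    sumPerms (suc m) G
      ∎
    where open ≡-Reasoning

  sumPerms-+ : ∀ m (F G : List ℕ → ℕ) → sumPerms m (λ σ → F σ + G σ) ≡ sumPerms m F + sumPerms m G
  sumPerms-+ m F G = trans (sumWords-cong (upTo m) m pointwise) (sumWords-+ (upTo m) m (onDistinct F) (onDistinct G))
    where
    pointwise : ∀ w → onDistinct (λ σ → F σ + G σ) w ≡ onDistinct F w + onDistinct G w
    pointwise w with distinctᵇ w
    ... | true  = refl
    ... | false = refl

  sumPerms-*ˡ : ∀ m c (F : List ℕ → ℕ) → sumPerms m (λ σ → c * F σ) ≡ c * sumPerms m F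
  sumPerms-*ˡ m c F = trans (sumWords-cong (upTo m) m pointwise) (sumWords-*ˡ (upTo m) m c (onDistinct F))
    where
    pointwise : ∀ w → onDistinct (λ σ → c * F σ) w ≡ c * onDistinct F w
    pointwise w with distinctᵇ w
    ... | true  = refl
    ... | false = sym (*-zeroʳ c)

  sumPerms-zero : ∀ m → sumPerms m (λ _ → 0) ≡ 0
  sumPerms-zero m = sumPerms-*ˡ m 0 (λ _ → 0)

  countᵇ->-punchIn : ∀ b σ → countᵇ (b <ᵇ_) (map (punchIn b) σ) ≡ countᵇ (b ≤ᵇ_) σ
  countᵇ->-punchIn b σ = trans (countᵇ-map _ (punchIn b) σ) (countᵇ-cong (λ y → punchIn-<ᵇ-above b y ≤-refl) σ)

  count12-∷punchIn : ∀ b σ → count12 (b ∷ map (punchIn b) σ) ≡ countᵇ (b ≤ᵇ_) σ + count12 σ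
  count12-∷punchIn b σ = cong₂ _+_ (countᵇ->-punchIn b σ)
    (trans (pairCount-map _ (punchIn b) σ) (pairCount-cong (punchIn-<ᵇ b) σ))

  count21-∷punchIn : ∀ b σ → count21 (b ∷ map (punchIn b) σ) ≡ countᵇ (_<ᵇ b) σ + count21 σ
  count21-∷punchIn b σ = cong₂ _+_
    (trans (countᵇ-map _ (punchIn b) σ) (countᵇ-cong (punchIn-<ᵇ-pivot b) σ))
    (trans (pairCount-map _ (punchIn b) σ) (pairCount-cong (λ y z → punchIn-<ᵇ b z y) σ))

  count12≥-punchIn-below : ∀ {t b} σ → t ≤ b → count12≥ t (map (punchIn b) σ) ≡ count12≥ t σ
  count12≥-punchIn-below {b = b} σ t≤b = trans (pairCount-map _ (punchIn b) σ)
    (pairCount-cong (λ y z → cong₂ _∧_ (punchIn-≤ᵇ-below b y t≤b) (punchIn-<ᵇ b y z)) σ)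

  count12≥-punchIn-above : ∀ {t b} σ → b ≤ t → count12≥ (suc t) (map (punchIn b) σ) ≡ count12≥ t σ
  count12≥-punchIn-above {b = b} σ b≤t = trans (pairCount-map _ (punchIn b) σ)
    (pairCount-cong (λ y z → cong₂ _∧_ (punchIn-<ᵇ-above b y b≤t) (punchIn-<ᵇ b y z)) σ)

  count123-punchIn : ∀ b σ → count123 (map (punchIn b) σ) ≡ count123 σ
  count123-punchIn b []      = refl
  count123-punchIn b (x ∷ σ) = cong₂ _+_
    (trans (pairCount-map _ (punchIn b) σ)
           (pairCount-cong (λ y z → cong₂ _∧_ (punchIn-<ᵇ b x y) (punchIn-<ᵇ b y z)) σ))
    (count123-punchIn b σ)

  count123-∷punchIn : ∀ b σ → count123 (b ∷ map (punchIn b) σ) ≡ count12≥ b σ + count123 σ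
  count123-∷punchIn b σ = cong₂ _+_ (count12≥-punchIn-above σ ≤-refl) (count123-punchIn b σ)

  count12≥-∷punchIn-≤ : ∀ {t b} σ → t ≤ b →
    count12≥ t (b ∷ map (punchIn b) σ) ≡ countᵇ (b ≤ᵇ_) σ + count12≥ t σ
  count12≥-∷punchIn-≤ {t} {b} σ t≤b rewrite ≤⇒≤ᵇ≡true t≤b =
    cong₂ _+_ (countᵇ->-punchIn b σ) (count12≥-punchIn-below σ t≤b)

  count12≥-∷punchIn-> : ∀ {t b} σ → b ≤ t → count12≥ (suc t) (b ∷ map (punchIn b) σ) ≡ count12≥ t σ
  count12≥-∷punchIn-> {t} {b} σ b≤t rewrite ≮⇒<ᵇ≡false (≤⇒≯ b≤t) = cong₂ _+_
    (countᵇ-none (λ _ → refl) (map (punchIn b) σ)) (count12≥-punchIn-above σ b≤t)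

  IsPerm-count≥ : ∀ {m σ} → IsPerm m σ → ∀ t → countᵇ (t ≤ᵇ_) σ ≡ m ∸ t
  IsPerm-count≥ perm[] zero    = refl
  IsPerm-count≥ perm[] (suc t) = refl
  IsPerm-count≥ (perm∷ {m} {σ} b b<1+m σ∈) t with t ≤? b
  ... | yes t≤b rewrite ≤⇒≤ᵇ≡true t≤b = begin
    suc (countᵇ (t ≤ᵇ_) (map (punchIn b) σ)) ≡⟨ cong suc (countᵇ-map _ (punchIn b) σ) ⟩
    suc (countᵇ (λ y → t ≤ᵇ punchIn b y) σ)  ≡⟨ cong suc (countᵇ-cong (λ y → punchIn-≤ᵇ-below b y t≤b) σ) ⟩
    suc (countᵇ (t ≤ᵇ_) σ)                   ≡⟨ cong suc (IsPerm-count≥ σ∈ t) ⟩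
    suc (m ∸ t)                              ≡⟨ +-∸-assoc 1 (≤-trans t≤b (≤-pred b<1+m)) ⟨
    suc m ∸ t                                ∎
    where open ≡-Reasoning
  IsPerm-count≥ (perm∷ b b<1+m σ∈) zero    | no 0≰b = ⊥-elim (0≰b z≤n)
  IsPerm-count≥ (perm∷ {m} {σ} b b<1+m σ∈) (suc t) | no 1+t≰b rewrite ≰⇒≤ᵇ≡false 1+t≰b =
    trans (countᵇ-map _ (punchIn b) σ)
          (trans (countᵇ-cong (λ y → punchIn-<ᵇ-above b y (≤-pred (≰⇒> 1+t≰b))) σ) (IsPerm-count≥ σ∈ t))

  IsPerm-count12≥ : ∀ {m σ} → IsPerm m σ → count12≥ m σ ≡ 0
  IsPerm-count12≥ perm[]                         = refl
  IsPerm-count12≥ (perm∷ {σ = σ} b b<1+m σ∈) = trans (count12≥-∷punchIn-> σ (≤-pred b<1+m)) (IsPerm-count12≥ σ∈)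

  IsPerm-length : ∀ {m σ} → IsPerm m σ → length σ ≡ m
  IsPerm-length perm[]                         = refl
  IsPerm-length (perm∷ {σ = σ} b b<1+m σ∈) = cong suc (trans (length-map (punchIn b) σ) (IsPerm-length σ∈))

  <ᵇ≡not-≤ᵇ : ∀ y t → (y <ᵇ t) ≡ not (t ≤ᵇ y)
  <ᵇ≡not-≤ᵇ y t with y <? t
  ... | yes y<t rewrite <⇒<ᵇ≡true y<t | ≰⇒≤ᵇ≡false (<⇒≱ y<t) = refl
  ... | no  y≮t rewrite ≮⇒<ᵇ≡false y≮t | ≤⇒≤ᵇ≡true (≮⇒≥ y≮t) = refl

  IsPerm-count12+count21 : ∀ {m σ} → IsPerm m σ → count12 σ + count21 σ ≡ m C 2
  IsPerm-count12+count21 perm[] = refl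
  IsPerm-count12+count21 (perm∷ {m} {σ} b b<1+m σ∈) = begin
    count12 (b ∷ map (punchIn b) σ) + count21 (b ∷ map (punchIn b) σ)
      ≡⟨ cong₂ _+_ (count12-∷punchIn b σ) (count21-∷punchIn b σ) ⟩
    (countᵇ (b ≤ᵇ_) σ + count12 σ) + (countᵇ (_<ᵇ b) σ + count21 σ)
      ≡⟨ interchange (countᵇ (b ≤ᵇ_) σ) (count12 σ) _ _ ⟩
    (countᵇ (b ≤ᵇ_) σ + countᵇ (_<ᵇ b) σ) + (count12 σ + count21 σ)
      ≡⟨ cong₂ _+_ (countᵇ-complement (λ y → <ᵇ≡not-≤ᵇ y b) σ) (IsPerm-count12+count21 σ∈) ⟩
    length σ + m C 2
      ≡⟨ cong₂ _+_ (trans (IsPerm-length σ∈) (sym (nC1≡n m))) refl ⟩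
    m C 1 + m C 2
      ≡⟨ nCk+nC[k+1]≡[n+1]C[k+1] m 1 ⟩
    suc m C 2
      ∎
    where open ≡-Reasoning

  -- Admissible permutations

  count12≥-antitone : ∀ {s t} σ → s ≤ t → count12≥ t σ ≤ count12≥ s σ
  count12≥-antitone {s} {t} σ s≤t = pairCount-mono weaken σ
    where
    weaken : ∀ y z → T ((t ≤ᵇ y) ∧ (y <ᵇ z)) → T ((s ≤ᵇ y) ∧ (y <ᵇ z))
    weaken y z p with t ≤ᵇ y in t≤ᵇy
    ... | true rewrite ≤⇒≤ᵇ≡true (≤-trans s≤t (≤ᵇ⇒≤ t y (subst T (sym t≤ᵇy) _))) = p

  -- σ avoids 123 and its entries ≥ t decrease; for a permutation of length t this is 123-avoidance
  -- (IsPerm-admissible).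
  admissibleᵇ : ℕ → List ℕ → Bool
  admissibleᵇ t σ = (count123 σ + count12≥ t σ) ≡ᵇ 0

  ≡ᵇ0-absorb : ∀ {x y} c → y ≤ x → ((x + c + y) ≡ᵇ 0) ≡ ((c + x) ≡ᵇ 0)
  ≡ᵇ0-absorb {zero}  c z≤n rewrite +-identityʳ c = refl
  ≡ᵇ0-absorb {suc x} c _   rewrite +-≡ᵇ0 c (suc x) = sym (∧-zeroʳ (c ≡ᵇ 0))

  -- A first letter b ≥ t precedes every larger entry, so it must be the maximum m.
  admissibleᵇ-∷punchIn : ∀ {m σ} t b → b < suc m → IsPerm m σ →
    admissibleᵇ t (b ∷ map (punchIn b) σ) ≡ (if b <ᵇ t then admissibleᵇ b σ else (b ≡ᵇ m) ∧ admissibleᵇ t σ)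
  admissibleᵇ-∷punchIn t b b<1+m σ∈ with b <? t
  admissibleᵇ-∷punchIn {σ = σ} (suc t) b b<1+m σ∈ | yes b<1+t
    rewrite <⇒<ᵇ≡true b<1+t | count123-∷punchIn b σ | count12≥-∷punchIn-> σ (≤-pred b<1+t)
    = ≡ᵇ0-absorb (count123 σ) (count12≥-antitone σ (≤-pred b<1+t))
  admissibleᵇ-∷punchIn {m} {σ} t b b<1+m σ∈ | no b≮t
    rewrite ≮⇒<ᵇ≡false b≮t | count123-∷punchIn b σ | count12≥-∷punchIn-≤ σ (≮⇒≥ b≮t) | IsPerm-count≥ σ∈ b
    with b ≟ m
  ... | yes refl rewrite ≡ᵇ-refl b | IsPerm-count12≥ σ∈ | n∸n≡0 b = refl
  ... | no  b≢m rewrite ≢⇒≡ᵇ≡false b≢m | +-∸-assoc 1 (≤∧≢⇒< (≤-pred b<1+m) b≢m) =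
    trans (+-≡ᵇ0 (count12≥ b σ + count123 σ) _) (∧-zeroʳ _)

  admissibleCount admissibleOcc12 : ℕ → ℕ → ℕ
  admissibleCount m t = sumPerms m (λ σ → if admissibleᵇ t σ then 1 else 0)
  admissibleOcc12 m t = sumPerms m (λ σ → if admissibleᵇ t σ then count12 σ else 0)

  sum-upTo-if-< : ∀ (X : ℕ → ℕ) {t} m → t ≤ m →
    sum (map (λ b → if b <ᵇ t then X b else 0) (upTo m)) ≡ sum (map X (upTo t))
  sum-upTo-if-< X {t} m t≤m with t ≟ m
  ... | yes refl = sum-map-cong-upTo t (λ b b<t → cong (if_then X b else 0) (<⇒<ᵇ≡true b<t))
  sum-upTo-if-< X zero    z≤n | no 0≢0 = ⊥-elim (0≢0 refl)
  sum-upTo-if-< X {t} (suc m) t≤1+m | no t≢1+m = begin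
    sum (map (λ b → if b <ᵇ t then X b else 0) (upTo (suc m)))
      ≡⟨ sum-map-upTo-suc _ m ⟩
    sum (map (λ b → if b <ᵇ t then X b else 0) (upTo m)) + (if m <ᵇ t then X m else 0)
      ≡⟨ cong₂ _+_ (sum-upTo-if-< X m t≤m) (cong (if_then X m else 0) (≮⇒<ᵇ≡false (≤⇒≯ t≤m))) ⟩
    sum (map X (upTo t)) + 0
      ≡⟨ +-identityʳ _ ⟩
    sum (map X (upTo t))
      ∎
    where
    open ≡-Reasoning
    t≤m = ≤-pred (≤∧≢⇒< t≤1+m t≢1+m)

  firstLetterSum : (ℕ → ℕ) → ℕ → ℕ → ℕ → ℕ
  firstLetterSum X Y m t = sum (map (λ b → if b <ᵇ t then X b else if b ≡ᵇ m then Y else 0) (upTo (suc m)))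

  firstLetterSum-≤ : ∀ X Y {m t} → t ≤ m → firstLetterSum X Y m t ≡ sum (map X (upTo t)) + Y
  firstLetterSum-≤ X Y {m} {t} t≤m = begin
    firstLetterSum X Y m t
      ≡⟨ sum-map-upTo-suc _ m ⟩
    sum (map (λ b → if b <ᵇ t then X b else if b ≡ᵇ m then Y else 0) (upTo m))
      + (if m <ᵇ t then X m else if m ≡ᵇ m then Y else 0)
      ≡⟨ cong₂ _+_ (sum-map-cong-upTo m λ b b<m → cong (if b <ᵇ t then X b else_)
                                          (cong (if_then Y else 0) (≢⇒≡ᵇ≡false (<⇒≢ b<m))))
                   (cong₂ (if_then X m else_) (≮⇒<ᵇ≡false (≤⇒≯ t≤m))
                          (cong (if_then Y else 0) (≡ᵇ-refl m))) ⟩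
    sum (map (λ b → if b <ᵇ t then X b else 0) (upTo m)) + Y
      ≡⟨ cong (_+ Y) (sum-upTo-if-< X m t≤m) ⟩
    sum (map X (upTo t)) + Y
      ∎
    where open ≡-Reasoning

  firstLetterSum-diag : ∀ X Y m → firstLetterSum X Y m (suc m) ≡ sum (map X (upTo (suc m)))
  firstLetterSum-diag X Y m = sum-map-cong-upTo (suc m)
    (λ b b<1+m → cong (if_then X b else (if b ≡ᵇ m then Y else 0)) (<⇒<ᵇ≡true b<1+m))

  admissibleCount-suc : ∀ m t →
    admissibleCount (suc m) t ≡ firstLetterSum (admissibleCount m) (admissibleCount m t) m t
  admissibleCount-suc m t =
    trans (sumPerms-suc m (λ σ → if admissibleᵇ t σ then 1 else 0)) (sum-map-cong-upTo (suc m) firstLetter)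
    where
    firstLetter : ∀ b → b < suc m →
      sumPerms m (λ σ → if admissibleᵇ t (b ∷ map (punchIn b) σ) then 1 else 0)
        ≡ (if b <ᵇ t then admissibleCount m b else if b ≡ᵇ m then admissibleCount m t else 0)
    firstLetter b b<1+m
      rewrite sumPerms-cong m (λ σ σ∈ → cong (if_then 1 else 0) (admissibleᵇ-∷punchIn t b b<1+m σ∈))
      with b <ᵇ t | b ≡ᵇ m
    ... | true  | _     = refl
    ... | false | true  = refl
    ... | false | false = sumPerms-zero m

  if-+-distrib : ∀ c k x → (if c then k + x else 0) ≡ k * (if c then 1 else 0) + (if c then x else 0)
  if-+-distrib true  k x = cong (_+ x) (sym (*-identityʳ k))
  if-+-distrib false k x = sym (trans (+-identityʳ (k * 0)) (*-zeroʳ k))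

  admissibleOcc12-suc : ∀ m t →
    admissibleOcc12 (suc m) t
      ≡ firstLetterSum (λ b → (m ∸ b) * admissibleCount m b + admissibleOcc12 m b) (admissibleOcc12 m t) m t
  admissibleOcc12-suc m t =
    trans (sumPerms-suc m (λ σ → if admissibleᵇ t σ then count12 σ else 0)) (sum-map-cong-upTo (suc m) firstLetter)
    where
    firstLetter : ∀ b → b < suc m →
      sumPerms m (λ σ → if admissibleᵇ t (b ∷ map (punchIn b) σ) then count12 (b ∷ map (punchIn b) σ) else 0)
        ≡ (if b <ᵇ t then (m ∸ b) * admissibleCount m b + admissibleOcc12 m b
           else if b ≡ᵇ m then admissibleOcc12 m t else 0)
    firstLetter b b<1+m
      rewrite sumPerms-cong m (λ σ σ∈ → cong₂ (if_then_else 0) (admissibleᵇ-∷punchIn t b b<1+m σ∈)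
                                (trans (count12-∷punchIn b σ) (cong (_+ count12 σ) (IsPerm-count≥ σ∈ b))))
      with b <ᵇ t
    ... | true = begin
      sumPerms m (λ σ → if admissibleᵇ b σ then (m ∸ b) + count12 σ else 0)
        ≡⟨ sumPerms-cong m (λ σ _ → if-+-distrib (admissibleᵇ b σ) (m ∸ b) (count12 σ)) ⟩
      sumPerms m (λ σ → (m ∸ b) * (if admissibleᵇ b σ then 1 else 0)
                        + (if admissibleᵇ b σ then count12 σ else 0))
        ≡⟨ sumPerms-+ m _ _ ⟩
      sumPerms m (λ σ → (m ∸ b) * (if admissibleᵇ b σ then 1 else 0)) + admissibleOcc12 m b
        ≡⟨ cong (_+ admissibleOcc12 m b) (sumPerms-*ˡ m (m ∸ b) _) ⟩
      (m ∸ b) * admissibleCount m b + admissibleOcc12 m b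
        ∎
      where open ≡-Reasoning
    ... | false with b ≟ m
    ...   | yes refl rewrite ≡ᵇ-refl b | n∸n≡0 b = refl
    ...   | no  b≢m  rewrite ≢⇒≡ᵇ≡false b≢m = sumPerms-zero m

  IsPerm-admissible : ∀ {n σ} → IsPerm n σ → admissibleᵇ n σ ≡ avoidsᵇ p123 σ
  IsPerm-admissible {σ = σ} σ∈ rewrite IsPerm-count12≥ σ∈ | +-identityʳ (count123 σ) | occ-123 σ = refl

  totalOcc12 : ∀ n → totalOcc n p123 p12 ≡ admissibleOcc12 n n
  totalOcc12 n = trans (totalOcc-sumPerms n p123 p12) (sumPerms-cong n λ σ σ∈ →
    sym (cong₂ (if_then_else 0) (IsPerm-admissible σ∈) (sym (occ-12 σ))))

  totalOcc21 : ∀ n → totalOcc n p123 p21 + admissibleOcc12 n n ≡ (n C 2) * admissibleCount n n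
  totalOcc21 n = begin
    totalOcc n p123 p21 + admissibleOcc12 n n
      ≡⟨ cong (_+ admissibleOcc12 n n) (totalOcc-sumPerms n p123 p21) ⟩
    sumPerms n (λ σ → if avoidsᵇ p123 σ then occ p21 σ else 0) + admissibleOcc12 n n
      ≡⟨ sumPerms-+ n _ _ ⟨
    sumPerms n (λ σ → (if avoidsᵇ p123 σ then occ p21 σ else 0) + (if admissibleᵇ n σ then count12 σ else 0))
      ≡⟨ sumPerms-cong n pointwise ⟩
    sumPerms n (λ σ → (n C 2) * (if admissibleᵇ n σ then 1 else 0))
      ≡⟨ sumPerms-*ˡ n (n C 2) _ ⟩
    (n C 2) * admissibleCount n n
      ∎
    where
    open ≡-Reasoning
    pointwise : ∀ σ → IsPerm n σ →
      (if avoidsᵇ p123 σ then occ p21 σ else 0) + (if admissibleᵇ n σ then count12 σ else 0)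
        ≡ (n C 2) * (if admissibleᵇ n σ then 1 else 0)
    pointwise σ σ∈ rewrite IsPerm-admissible σ∈ | occ-21 σ with avoidsᵇ p123 σ
    ... | true  = trans (+-comm (count21 σ) (count12 σ))
                        (trans (IsPerm-count12+count21 σ∈) (sym (*-identityʳ (n C 2))))
    ... | false = sym (*-zeroʳ (n C 2))

  admissibleCount-suc-≤ : ∀ {m t} → t ≤ m →
    admissibleCount (suc m) t ≡ sum (map (admissibleCount m) (upTo (suc t)))
  admissibleCount-suc-≤ {m} {t} t≤m = trans (admissibleCount-suc m t)
    (trans (firstLetterSum-≤ (admissibleCount m) _ t≤m) (sym (sum-map-upTo-suc (admissibleCount m) t)))

  admissibleCount-suc-diag : ∀ m →
    admissibleCount (suc m) (suc m) ≡ sum (map (admissibleCount m) (upTo (suc m)))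
  admissibleCount-suc-diag m = trans (admissibleCount-suc m (suc m)) (firstLetterSum-diag _ _ m)

  admissibleOcc12-suc-≤ : ∀ {m t} → t ≤ m → admissibleOcc12 (suc m) t
    ≡ sum (map (λ b → (m ∸ b) * admissibleCount m b + admissibleOcc12 m b) (upTo t)) + admissibleOcc12 m t
  admissibleOcc12-suc-≤ {m} {t} t≤m = trans (admissibleOcc12-suc m t) (firstLetterSum-≤ _ _ t≤m)

  admissibleOcc12-suc-diag : ∀ m → admissibleOcc12 (suc m) (suc m)
    ≡ sum (map (λ b → (m ∸ b) * admissibleCount m b + admissibleOcc12 m b) (upTo (suc m)))
  admissibleOcc12-suc-diag m = trans (admissibleOcc12-suc m (suc m)) (firstLetterSum-diag _ _ m)

  -- Closed forms

  pascal : ∀ n k → suc n C suc k ≡ n C k + n C suc k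
  pascal n k = sym (nCk+nC[k+1]≡[n+1]C[k+1] n k)

  prevBinom : ℕ → ℕ → ℕ
  prevBinom n zero    = 0
  prevBinom n (suc k) = n C k

  pascal-prevBinom : ∀ n k → suc n C k ≡ prevBinom n k + n C k
  pascal-prevBinom n zero    = refl
  pascal-prevBinom n (suc k) = pascal n k

  [2m+1]C[m+1]≡[2m+1]Cm : ∀ m → suc (m + m) C suc m ≡ suc (m + m) C m
  [2m+1]C[m+1]≡[2m+1]Cm m = trans (nCk≡nC[n∸k] (s≤s (m≤m+n m m))) (cong (suc (m + m) C_) (m+n∸m≡n m m))

  ballot-prefixSum : ∀ {m} (f : ℕ → ℕ) → (∀ t → t ≤ m → f t + prevBinom (m + t) t ≡ (m + t) C t) →
    ∀ t → t ≤ m → sum (map f (upTo (suc t))) + prevBinom (suc m + t) t ≡ (suc m + t) C t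
  ballot-prefixSum f hf zero    _     = cong (_+ 0) (hf zero z≤n)
  ballot-prefixSum {m} f hf (suc t) 1+t≤m = begin
    sum (map f (upTo (suc (suc t)))) + prevBinom (suc m + suc t) (suc t)
      ≡⟨ cong₂ _+_ (sum-map-upTo-suc f (suc t)) (cong (λ n → suc n C t) (+-suc m t)) ⟩
    (sum (map f (upTo (suc t))) + f (suc t)) + suc (suc (m + t)) C t
      ≡⟨ cong (_ +_) (pascal-prevBinom (suc (m + t)) t) ⟩
    (sum (map f (upTo (suc t))) + f (suc t)) + (prevBinom (suc (m + t)) t + suc (m + t) C t)
      ≡⟨ telescope (sum (map f (upTo (suc t)))) (prevBinom (suc (m + t)) t)
                   (ballot-prefixSum f hf t (≤-trans (n≤1+n t) 1+t≤m))
                   (subst (λ n → f (suc t) + n C t ≡ n C suc t) (+-suc m t) (hf (suc t) 1+t≤m)) ⟩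
    suc (m + t) C t + suc (m + t) C suc t
      ≡⟨ pascal (suc (m + t)) t ⟨
    suc (suc (m + t)) C suc t
      ≡⟨ cong (λ n → suc n C suc t) (+-suc m t) ⟨
    (suc m + suc t) C suc t
      ∎
    where
    open ≡-Reasoning
    telescope : ∀ s p {a c c′} → s + p ≡ c → a + c ≡ c′ → (s + a) + (p + c) ≡ c + c′
    telescope s p {a} refl refl = rearrange s a p
      where
      rearrange : ∀ s a p → (s + a) + (p + (s + p)) ≡ (s + p) + (a + (s + p))
      rearrange = solve-∀

  admissibleCount-ballot : ∀ m t → t ≤ m → admissibleCount m t + prevBinom (m + t) t ≡ (m + t) C t
  admissibleCount-ballot zero    zero z≤n  = refl
  admissibleCount-ballot (suc m) t  t≤1+m with m≤n⇒m<n∨m≡n t≤1+m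
  ... | inj₁ t<1+m = trans (cong (_+ prevBinom (suc m + t) t) (admissibleCount-suc-≤ (≤-pred t<1+m)))
                           (ballot-prefixSum (admissibleCount m) (admissibleCount-ballot m) t (≤-pred t<1+m))
  ... | inj₂ refl  = begin
    admissibleCount (suc m) (suc m) + prevBinom (suc m + suc m) (suc m)
      ≡⟨ cong₂ _+_ (admissibleCount-suc-diag m) (cong (λ n → suc n C m) (+-suc m m)) ⟩
    sum (map (admissibleCount m) (upTo (suc m))) + suc N C m
      ≡⟨ cong (sum (map (admissibleCount m) (upTo (suc m))) +_) (pascal-prevBinom N m) ⟩
    sum (map (admissibleCount m) (upTo (suc m))) + (prevBinom N m + N C m)
      ≡⟨ +-assoc _ (prevBinom N m) (N C m) ⟨
    (sum (map (admissibleCount m) (upTo (suc m))) + prevBinom N m) + N C m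
      ≡⟨ cong (_+ N C m) (ballot-prefixSum (admissibleCount m) (admissibleCount-ballot m) m ≤-refl) ⟩
    N C m + N C m
      ≡⟨ cong (N C m +_) ([2m+1]C[m+1]≡[2m+1]Cm m) ⟨
    N C m + N C suc m
      ≡⟨ pascal N m ⟨
    suc N C suc m
      ≡⟨ cong (λ n → suc n C suc m) (+-suc m m) ⟨
    (suc m + suc m) C suc m
      ∎
    where
    open ≡-Reasoning
    N = suc (m + m)

  binomPrefix : ℕ → ℕ → ℕ
  binomPrefix n zero    = 0
  binomPrefix n (suc k) = binomPrefix n k + n C k

  binomPrefix-pascal : ∀ n k → binomPrefix (suc n) (suc k) ≡ binomPrefix n (suc k) + binomPrefix n k
  binomPrefix-pascal n zero    = refl
  binomPrefix-pascal n (suc k) = trans (cong₂ _+_ (binomPrefix-pascal n k) (pascal n k))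
                                       (rearrange (binomPrefix n k) (n C k) (n C suc k))
    where
    rearrange : ∀ w a c → (w + a + w) + (a + c) ≡ (w + a + c) + (w + a)
    rearrange = solve-∀

  triangle : ℕ → ℕ
  triangle zero    = 0
  triangle (suc u) = suc u + triangle u

  -- admissibleOcc12 m (s + 1) in terms of N = m + s and u = m - (s + 1)
  occ12Formula : ℕ → ℕ → ℕ → ℕ
  occ12Formula N s u = suc u * binomPrefix N s + triangle u * (N C s)

  occ12Closed : ℕ → ℕ → ℕ
  occ12Closed m zero    = 0
  occ12Closed m (suc s) = occ12Formula (m + s) s (m ∸ suc s)

  occ12Closed-step-+ : ∀ t u → let m = suc t + u in
    occ12Closed (suc m) (suc t) + (m ∸ t) * prevBinom (m + t) t
      ≡ occ12Closed (suc m) t + occ12Closed m (suc t) + (m ∸ t) * ((m + t) C t)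
  occ12Closed-step-+ zero    u = algebra u (triangle u)
    where
    algebra : ∀ u T → suc (suc u) * 0 + (suc u + T) * 1 + suc u * 0 ≡ 0 + (suc u * 0 + T * 1) + suc u * 1
    algebra = solve-∀
  occ12Closed-step-+ (suc s) u = begin
    occ12Closed (suc m) (suc (suc s)) + (m ∸ suc s) * prevBinom (m + suc s) (suc s)
      ≡⟨ cong (λ v → occ12Formula (suc n₀) (suc s) v + v * (n₀ C s)) m∸[1+s] ⟩
    suc (suc u) * binomPrefix (suc n₀) (suc s) + triangle (suc u) * (suc n₀ C suc s) + suc u * (n₀ C s)
      ≡⟨ cong₂ (λ W c → suc (suc u) * W + triangle (suc u) * c + suc u * (n₀ C s))
               (binomPrefix-pascal n₀ s) (pascal n₀ s) ⟩
    suc (suc u) * (binomPrefix n₀ (suc s) + binomPrefix n₀ s) + triangle (suc u) * (n₀ C s + n₀ C suc s)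
      + suc u * (n₀ C s)
      ≡⟨ algebra u (triangle u) (binomPrefix n₀ s) (n₀ C s) (n₀ C suc s) ⟩
    occ12Formula n₀ s (suc (suc u)) + occ12Formula n₀ (suc s) u + suc u * (n₀ C suc s)
      ≡⟨ cong₂ (λ N v → occ12Formula N s v + occ12Formula n₀ (suc s) u + suc u * (n₀ C suc s))
               (sym (+-suc m s)) m∸s ⟨
    occ12Closed (suc m) (suc s) + occ12Formula n₀ (suc s) u + suc u * (n₀ C suc s)
      ≡⟨ cong₂ (λ w v → occ12Closed (suc m) (suc s) + occ12Formula n₀ (suc s) w + v * (n₀ C suc s))
               m∸[2+s] m∸[1+s] ⟨
    occ12Closed (suc m) (suc s) + occ12Closed m (suc (suc s)) + (m ∸ suc s) * ((m + suc s) C suc s)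
      ∎
    where
    open ≡-Reasoning
    m  = suc (suc s) + u
    n₀ = m + suc s
    m∸[2+s] : m ∸ suc (suc s) ≡ u
    m∸[2+s] = m+n∸m≡n s u
    m∸[1+s] : m ∸ suc s ≡ suc u
    m∸[1+s] = trans (cong (_∸ s) (sym (+-suc s u))) (m+n∸m≡n s (suc u))
    m∸s : m ∸ s ≡ suc (suc u)
    m∸s = trans (cong (_∸ s) (trans (cong suc (sym (+-suc s u))) (sym (+-suc s (suc u)))))
                (m+n∸m≡n s (suc (suc u)))
    algebra : ∀ u T w a c →
      suc (suc u) * ((w + a) + w) + (suc u + T) * (a + c) + suc u * a
        ≡ suc (suc (suc u)) * w + (suc (suc u) + (suc u + T)) * a + (suc u * (w + a) + T * c) + suc u * c
    algebra = solve-∀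

  occ12Closed-step : ∀ {m t} → suc t ≤ m →
    occ12Closed (suc m) (suc t) + (m ∸ t) * prevBinom (m + t) t
      ≡ occ12Closed (suc m) t + occ12Closed m (suc t) + (m ∸ t) * ((m + t) C t)
  occ12Closed-step {m} {t} 1+t≤m rewrite sym (m+[n∸m]≡n 1+t≤m) = occ12Closed-step-+ t (m ∸ suc t)

  occ12Closed-diag : ∀ m → occ12Closed (suc m) (suc m) ≡ occ12Closed (suc m) m
  occ12Closed-diag zero    = refl
  occ12Closed-diag (suc s) = begin
    occ12Closed (suc (suc s)) (suc (suc s))
      ≡⟨ cong₂ (λ N u → occ12Formula N (suc s) u) (cong (λ n → suc (suc n)) (+-suc s s)) (n∸n≡0 s) ⟩
    occ12Formula (suc n₁) (suc s) 0
      ≡⟨ cong (λ W → 1 * W + 0 * (suc n₁ C suc s)) (binomPrefix-pascal n₁ s) ⟩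
    1 * ((binomPrefix n₁ s + n₁ C s) + binomPrefix n₁ s) + 0 * (suc n₁ C suc s)
      ≡⟨ algebra (binomPrefix n₁ s) (n₁ C s) (suc n₁ C suc s) ⟩
    occ12Formula n₁ s 1
      ≡⟨ cong (occ12Formula n₁ s) (m+n∸n≡m 1 s) ⟨
    occ12Closed (suc (suc s)) (suc s)
      ∎
    where
    open ≡-Reasoning
    n₁ = suc (suc (s + s))
    algebra : ∀ w a x → 1 * ((w + a) + w) + 0 * x ≡ 2 * w + (1 + 0) * a
    algebra = solve-∀

  occ12Closed-prefixSum : ∀ {m} (a b : ℕ → ℕ) →
    (∀ t → t ≤ m → a t + prevBinom (m + t) t ≡ (m + t) C t) → (∀ t → t ≤ m → b t ≡ occ12Closed m t) →
    ∀ t → t ≤ m → sum (map (λ j → (m ∸ j) * a j + b j) (upTo t)) + b t ≡ occ12Closed (suc m) t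
  occ12Closed-prefixSum a b ha hb zero    _     = hb zero z≤n
  occ12Closed-prefixSum {m} a b ha hb (suc t) 1+t≤m = begin
    sum (map f (upTo (suc t))) + b (suc t)
      ≡⟨ cong (_+ b (suc t)) (sum-map-upTo-suc f t) ⟩
    sum (map f (upTo t)) + ((m ∸ t) * a t + b t) + b (suc t)
      ≡⟨ regroup (sum (map f (upTo t))) ((m ∸ t) * a t) (b t) (b (suc t)) ⟩
    (sum (map f (upTo t)) + b t) + (m ∸ t) * a t + b (suc t)
      ≡⟨ cong₂ (λ x y → x + (m ∸ t) * a t + y)
               (occ12Closed-prefixSum a b ha hb t t≤m) (hb (suc t) 1+t≤m) ⟩
    occ12Closed (suc m) t + (m ∸ t) * a t + occ12Closed m (suc t)
      ≡⟨ cancel (m ∸ t) (occ12Closed (suc m) t) (occ12Closed m (suc t))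
                (ha t t≤m) (occ12Closed-step 1+t≤m) ⟩
    occ12Closed (suc m) (suc t)
      ∎
    where
    open ≡-Reasoning
    f = λ j → (m ∸ j) * a j + b j
    t≤m = ≤-trans (n≤1+n t) 1+t≤m
    regroup : ∀ s x y z → s + (x + y) + z ≡ (s + y) + x + z
    regroup = solve-∀
    cancel : ∀ k β₀ β₁ {x p c β} → x + p ≡ c → β + k * p ≡ β₀ + β₁ + k * c → β₀ + k * x + β₁ ≡ β
    cancel k β₀ β₁ {x} {p} refl h = +-cancelʳ-≡ (k * p) _ _ (trans (expand k x p β₀ β₁) (sym h))
      where
      expand : ∀ k x p β₀ β₁ → β₀ + k * x + β₁ + k * p ≡ β₀ + β₁ + k * (x + p)
      expand = solve-∀

  admissibleOcc12-closed : ∀ m t → t ≤ m → admissibleOcc12 m t ≡ occ12Closed m t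
  admissibleOcc12-closed zero    zero z≤n = refl
  admissibleOcc12-closed (suc m) t  t≤1+m with m≤n⇒m<n∨m≡n t≤1+m
  ... | inj₁ t<1+m = trans (admissibleOcc12-suc-≤ (≤-pred t<1+m)) (prefixSum t (≤-pred t<1+m))
    where prefixSum = occ12Closed-prefixSum _ _ (admissibleCount-ballot m) (admissibleOcc12-closed m)
  ... | inj₂ refl  = begin
    admissibleOcc12 (suc m) (suc m)
      ≡⟨ admissibleOcc12-suc-diag m ⟩
    sum (map f (upTo (suc m)))
      ≡⟨ sum-map-upTo-suc f m ⟩
    sum (map f (upTo m)) + ((m ∸ m) * admissibleCount m m + admissibleOcc12 m m)
      ≡⟨ cong (λ k → sum (map f (upTo m)) + (k * admissibleCount m m + admissibleOcc12 m m)) (n∸n≡0 m) ⟩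
    sum (map f (upTo m)) + admissibleOcc12 m m
      ≡⟨ occ12Closed-prefixSum _ _ (admissibleCount-ballot m) (admissibleOcc12-closed m) m ≤-refl ⟩
    occ12Closed (suc m) m
      ≡⟨ occ12Closed-diag m ⟨
    occ12Closed (suc m) (suc m)
      ∎
    where
    open ≡-Reasoning
    f = λ b → (m ∸ b) * admissibleCount m b + admissibleOcc12 m b

  [k+1]*[n+1]C[k+1]≡[n+1]*nCk : ∀ n k → suc k * (suc n C suc k) ≡ suc n * (n C k)
  [k+1]*[n+1]C[k+1]≡[n+1]*nCk zero    zero    = refl
  [k+1]*[n+1]C[k+1]≡[n+1]*nCk zero    (suc k) = *-zeroʳ (suc (suc k))
  [k+1]*[n+1]C[k+1]≡[n+1]*nCk (suc n) zero    =
    trans (+-identityʳ _) (trans (nC1≡n (suc (suc n))) (sym (*-identityʳ (suc (suc n)))))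
  [k+1]*[n+1]C[k+1]≡[n+1]*nCk (suc n) (suc k) = begin
    suc (suc k) * (suc (suc n) C suc (suc k))
      ≡⟨ cong (suc (suc k) *_) (pascal (suc n) (suc k)) ⟩
    suc (suc k) * (suc n C suc k + suc n C suc (suc k))
      ≡⟨ cong (λ x → suc (suc k) * (x + suc n C suc (suc k))) (pascal n k) ⟩
    suc (suc k) * ((n C k + n C suc k) + suc n C suc (suc k))
      ≡⟨ combine (subst (λ x → suc k * x ≡ suc n * (n C k)) (pascal n k) ([k+1]*[n+1]C[k+1]≡[n+1]*nCk n k))
                 ([k+1]*[n+1]C[k+1]≡[n+1]*nCk n (suc k)) ⟩
    suc (suc n) * (n C k + n C suc k)
      ≡⟨ cong (suc (suc n) *_) (pascal n k) ⟨
    suc (suc n) * (suc n C suc k)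
      ∎
    where
    open ≡-Reasoning
    combine : ∀ {a b y} → suc k * (a + b) ≡ suc n * a → suc (suc k) * y ≡ suc n * b →
      suc (suc k) * ((a + b) + y) ≡ suc (suc n) * (a + b)
    combine {a} {b} {y} h₁ h₂ =
      trans (split k a b y) (trans (cong₂ (λ p q → p + (a + b) + q) h₁ h₂) (join n a b))
      where
      split : ∀ k a b y → suc (suc k) * ((a + b) + y) ≡ suc k * (a + b) + (a + b) + suc (suc k) * y
      split = solve-∀
      join : ∀ n a b → suc n * a + (a + b) + suc n * b ≡ suc (suc n) * (a + b)
      join = solve-∀

  -- A(n,n) + C(2n,n-1) = C(2n,n) by the ballot identity, and n·C(2n,n) = (n+1)·C(2n,n-1).
  catalan : ∀ n → admissibleCount n n ≡ ((2 * n) C n) / suc n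
  catalan zero    = refl
  catalan (suc k) = begin
    admissibleCount n n
      ≡⟨ m*n/n≡m (admissibleCount n n) (suc n) ⟨
    admissibleCount n n * suc n / suc n
      ≡⟨ cong (_/ suc n) (+-cancelʳ-≡ (suc n * (N C k)) (admissibleCount n n * suc n) (N C n)
           (scale (admissibleCount n n) (N C k) (admissibleCount-ballot n n ≤-refl) ratio)) ⟩
    (N C n) / suc n
      ≡⟨ cong (λ x → (x C n) / suc n) (cong (n +_) (+-identityʳ n)) ⟨
    ((2 * n) C n) / suc n
      ∎
    where
    open ≡-Reasoning
    n = suc k
    N = n + n
    ratio : suc k * (N C n) ≡ suc n * (N C k)
    ratio = +-cancelˡ-≡ (suc k * (N C k)) _ _ (begin
      suc k * (N C k) + suc k * (N C n)  ≡⟨ *-distribˡ-+ (suc k) (N C k) (N C n) ⟨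
      suc k * (N C k + N C n)            ≡⟨ cong (suc k *_) (pascal N k) ⟨
      suc k * (suc N C n)                ≡⟨ [k+1]*[n+1]C[k+1]≡[n+1]*nCk N k ⟩
      suc N * (N C k)                    ≡⟨ split k (N C k) ⟩
      suc k * (N C k) + suc n * (N C k)  ∎)
      where
      split : ∀ k x → suc ((suc k) + (suc k)) * x ≡ suc k * x + suc (suc k) * x
      split = solve-∀
    scale : ∀ a p {c} → a + p ≡ c → suc k * c ≡ suc n * p → a * suc n + suc n * p ≡ c + suc n * p
    scale a p refl r = trans (expand a p k) (cong (a + p +_) r)
      where
      expand : ∀ a p k → a * suc (suc k) + suc (suc k) * p ≡ a + p + suc k * (a + p)
      expand = solve-∀

  binomPrefix-half : ∀ s → binomPrefix (suc (s + s)) (suc s) ≡ 4 ^ s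
  binomPrefix-half zero    = refl
  binomPrefix-half (suc s) = begin
    binomPrefix (suc (suc s + suc s)) (suc (suc s))
      ≡⟨ cong (λ N → binomPrefix (suc N) (suc (suc s))) (+-suc (suc s) s) ⟩
    binomPrefix (suc (suc n₁)) (suc (suc s))
      ≡⟨ binomPrefix-pascal (suc n₁) (suc s) ⟩
    binomPrefix (suc n₁) (suc (suc s)) + binomPrefix (suc n₁) (suc s)
      ≡⟨ cong₂ _+_ (binomPrefix-pascal n₁ (suc s)) (binomPrefix-pascal n₁ s) ⟩
    (binomPrefix n₁ (suc (suc s)) + binomPrefix n₁ (suc s)) + (binomPrefix n₁ (suc s) + binomPrefix n₁ s)
      ≡⟨ cong (λ c → (W + c + W) + (W + binomPrefix n₁ s)) ([2m+1]C[m+1]≡[2m+1]Cm s) ⟩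
    (binomPrefix n₁ (suc s) + n₁ C s + binomPrefix n₁ (suc s)) + (binomPrefix n₁ (suc s) + binomPrefix n₁ s)
      ≡⟨ quadruple (binomPrefix n₁ s) (n₁ C s) ⟩
    4 * binomPrefix n₁ (suc s)
      ≡⟨ cong (4 *_) (binomPrefix-half s) ⟩
    4 ^ suc s
      ∎
    where
    open ≡-Reasoning
    n₁ = suc (s + s)
    W  = binomPrefix n₁ (suc s)
    quadruple : ∀ w a → (w + a + a + (w + a)) + ((w + a) + w) ≡ 4 * (w + a)
    quadruple = solve-∀

  admissibleOcc12-diag : ∀ s → admissibleOcc12 (suc s) (suc s) + (2 * suc s ∸ 1) C suc s ≡ 4 ^ s
  admissibleOcc12-diag s = begin
    admissibleOcc12 (suc s) (suc s) + (2 * suc s ∸ 1) C suc s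
      ≡⟨ cong₂ _+_ (admissibleOcc12-closed (suc s) (suc s) ≤-refl) (cong (_C suc s) 2[1+s]∸1≡N) ⟩
    occ12Formula (suc s + s) s (s ∸ s) + N C suc s
      ≡⟨ cong₂ (λ u c → occ12Formula N s u + c) (n∸n≡0 s) ([2m+1]C[m+1]≡[2m+1]Cm s) ⟩
    1 * binomPrefix N s + 0 * (N C s) + N C s
      ≡⟨ simplify (binomPrefix N s) (N C s) ⟩
    binomPrefix N (suc s)
      ≡⟨ binomPrefix-half s ⟩
    4 ^ s
      ∎
    where
    open ≡-Reasoning
    N = suc (s + s)
    2[1+s]∸1≡N : 2 * suc s ∸ 1 ≡ N
    2[1+s]∸1≡N = trans (cong (λ x → suc s + x ∸ 1) (+-identityʳ (suc s))) (+-suc s s)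
    simplify : ∀ w a → 1 * w + 0 * a + a ≡ w + a
    simplify = solve-∀

open import Data.Nat using (ℕ; suc; _≥_; _∸_; _^_; _*_; _/_)
open import Data.Nat.Combinatorics using (_C_)
open import Data.Integer using (ℤ; +_; _+_; _-_)
open import Data.Product using (_×_; _,_)
open import Relation.Binary.PropositionalEquality using (_≡_; refl; sym; trans; cong)
open import Data.Integer.Properties using (pos-+)
open import Data.Integer.Tactic.RingSolver using (solve-∀)
import Data.Nat as ℕ

sum⇒difference : ∀ {x y z} → x ℕ.+ y ≡ z → + x ≡ + z - + y
sum⇒difference {x} {y} refl = trans (cancel (+ x) (+ y)) (cong (_- + y) (sym (pos-+ x y)))
  where
  cancel : ∀ a b → a ≡ (a + b) - b
  cancel = solve-∀

proposition2p7 : (n : ℕ) → n ≥ 1 →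
    (+ totalOcc n p123 p12 ≡ + (4 ^ (n ∸ 1)) - + ((2 * n ∸ 1) C n))
  × (+ totalOcc n p123 p21
       ≡ + ((n C 2) * (((2 * n) C n) / suc n)) - + (4 ^ (n ∸ 1)) + + ((2 * n ∸ 1) C n))
proposition2p7 (suc s) _ = occ12-total , occ21-total
  where
  n = suc s
  c = (2 * n ∸ 1) C n
  occ12-diag : + admissibleOcc12 n n ≡ + (4 ^ s) - + c
  occ12-diag = sum⇒difference (admissibleOcc12-diag s)
  occ12-total : + totalOcc n p123 p12 ≡ + (4 ^ s) - + c
  occ12-total = trans (cong +_ (totalOcc12 n)) occ12-diag
  occ21-total : + totalOcc n p123 p21 ≡ + ((n C 2) * (((2 * n) C n) / suc n)) - + (4 ^ s) + + c
  occ21-total = trans (sum⇒difference (trans (totalOcc21 n) (cong ((n C 2) *_) (catalan n))))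
    (trans (cong (+ ((n C 2) * (((2 * n) C n) / suc n)) -_) occ12-diag)
           (reassociate (+ ((n C 2) * (((2 * n) C n) / suc n))) (+ (4 ^ s)) (+ c)))
    where
    reassociate : ∀ (a b c : ℤ) → a - (b - c) ≡ a - b + c
    reassociate = solve-∀
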